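{- For every integer $n\ge 4$, the Kurepa binary determinants satisfy $K_{2n}'=K_{2n-1}'=(-1)^n$.
   Context: For an integer $N\ge 7$ let $m=N-4$ and let $M_N=(a_{ij})_{1\le i,j\le m}$ be the integer matrix (the Kurepa matrix) with entries: row $1$: $a_{1j}=1$ for $1\le j\le m-1$ and $a_{1m}=3$; for $2\le i\le m-1$: $a_{ij}=0$ if $j<i-2$, $a_{i,i-2}=1$ (when $i\ge 3$), $a_{i,i-1}=i+1$, $a_{ij}=1$ for $i\le j\le m-1$, and $a_{im}=2$; last row $m$: $a_{mj}=0$ for $j\le m-2$, $a_{m,m-1}=1$, $a_{mm}=-4$. (E.g. for $N=7$: rows $(1,1,3),(3,1,2),(0,1,-4)$; the entry $a_{m-1,m-2}$ equals $N-4$.) The Kurepa determinant is $K_N=\det M_N$. The Kurepa binary determinant $K_N'$ is the determinant of the $m\times m$ matrix obtained from $M_N$ by replacing every odd entry by $1$ and every even entry by $0$. -}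

module Defs where

open import Data.Nat as ℕ using (ℕ; zero; suc; _∸_; _<ᵇ_; _≡ᵇ_)
open import Data.Nat.DivMod using (_%_)
open import Data.Bool using (Bool; true; false; if_then_else_; _∧_)
open import Data.Fin as Fin using (Fin; toℕ; punchIn)
open import Data.Integer using (ℤ; +_; -_; _+_; _*_; ∣_∣)

Matrix : ℕ → Set
Matrix m = Fin m → Fin m → ℤ

sgn : ℕ → ℤ
sgn zero = + 1
sgn (suc k) = - sgn k

sumFin : ∀ {k} → (Fin k → ℤ) → ℤ
sumFin {zero} f = + 0
sumFin {suc k} f = f Fin.zero + sumFin (λ i → f (Fin.suc i))

minor : ∀ {m} → Matrix (suc m) → Fin (suc m) → Matrix m
minor A j r c = A (Fin.suc r) (punchIn j c)

det : ∀ {m} → Matrix m → ℤ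
det {zero} A = + 1
det {suc m} A = sumFin (λ j → sgn (toℕ j) * (A Fin.zero j * det (minor A j)))

-- Entry a_{ij} of the Kurepa matrix M_N, with 1-based indices i j and m = N ∸ 4.
kurepaEntry : ℕ → ℕ → ℕ → ℤ
kurepaEntry N i j =
  if i ≡ᵇ 1 then (if j ≡ᵇ m then + 3 else + 1)
  else if i ≡ᵇ m then
    (if j ≡ᵇ m then - (+ 4) else if suc j ≡ᵇ m then + 1 else + 0)
  else
    (if j ≡ᵇ m then + 2
     else if suc j ≡ᵇ i then + (suc i)
     else if suc (suc j) ≡ᵇ i then + 1
     else if i ℕ.≤ᵇ j then + 1
     else + 0)
  where m = N ∸ 4

kurepaMatrix : (N : ℕ) → Matrix (N ∸ 4)
kurepaMatrix N i j = kurepaEntry N (suc (toℕ i)) (suc (toℕ j))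

parity : ℤ → ℤ
parity x = + (∣ x ∣ % 2)

binaryMatrix : ∀ {m} → Matrix m → Matrix m
binaryMatrix A i j = parity (A i j)

K : ℕ → ℤ
K N = det (kurepaMatrix N)

K′ : ℕ → ℤ
K′ N = det (binaryMatrix (kurepaMatrix N))

-- Let B_m be the binary Kurepa matrix of size m = N - 4, so that K′_N = det B_m, and let
-- the tail matrix T_{m-1} be B_m without its first row and its last column (rows and
-- columns of M_N are numbered from 1, as in the paper).  Both reductions below are the
-- same row operation: subtract row 2 from row 1, then expand along the new row 1.
--  * Rows 1, 2 of B_m are (1,…,1,1) and (1,…,1,0), so det B_m = (-1)^(m-1) det T_{m-1}.
--  * Rows 1, 2 of T_{s+4} are (1,1,1,…,1) and (1,0,1,…,1); the remaining minor has
--    first column (1,0,…,0)ᵀ and, as the pattern of M_N modulo 2 is invariant under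
--    shifting row, column and size by 2, its complementary minor is T_{s+2}.  Hence
--    det T_{s+4} = - det T_{s+2}.
-- Together these give K′_{N+2} = - K′_N for N ≥ 7, and K′_7 = K′_8 = 1 by computation.
module Submission where

open import Defs
open import Data.Nat using (ℕ; _≤_; _*_; _∸_)
open import Data.Product using (_×_)
open import Relation.Binary.PropositionalEquality using (_≡_)

open import Data.Nat using (zero; suc; s≤s; z≤n)
open import Data.Product using (_,_)
open import Data.Fin using (Fin; zero; suc; punchIn)
open import Data.Integer using (ℤ; +_; -_) renaming (_*_ to _·_)
open import Function using (_∘_)
open import Relation.Binary.PropositionalEquality using (_≢_; refl; sym; trans; cong; cong₂; module ≡-Reasoning)

module FiniteSums where
  open import Data.Integer using (_+_; -1ℤ)
  open import Data.Integer.Properties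
    using (+-0-commutativeMonoid; +-*-semiring; -1*i≡-i)
  open import Algebra.Properties.CommutativeMonoid.Sum +-0-commutativeMonoid
    using (sum; sum-cong-≗; sum-replicate-zero; ∑-distrib-+; ∑-comm; sum-remove)
  open import Algebra.Properties.Semiring.Sum +-*-semiring using (*-distribˡ-sum)
  open ≡-Reasoning

  sumFin≡sum : ∀ {k} (f : Fin k → ℤ) → sumFin f ≡ sum f
  sumFin≡sum {zero}  f = refl
  sumFin≡sum {suc k} f = cong (λ s → f zero + s) (sumFin≡sum (f ∘ suc))

  sumFin₂≡sum₂ : ∀ {k l} (H : Fin k → Fin l → ℤ) →
    sumFin (λ x → sumFin (H x)) ≡ sum (λ x → sum (H x))
  sumFin₂≡sum₂ H = trans (sumFin≡sum (λ x → sumFin (H x))) (sum-cong-≗ (λ x → sumFin≡sum (H x)))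

  sumFin-cong : ∀ {k} {f g : Fin k → ℤ} → (∀ i → f i ≡ g i) → sumFin f ≡ sumFin g
  sumFin-cong {f = f} {g} f≗g =
    trans (sumFin≡sum f) (trans (sum-cong-≗ f≗g) (sym (sumFin≡sum g)))

  sumFin-zero : ∀ {k} {f : Fin k → ℤ} → (∀ i → f i ≡ + 0) → sumFin f ≡ + 0
  sumFin-zero {k} {f} f≗0 =
    trans (sumFin≡sum f) (trans (sum-cong-≗ f≗0) (sum-replicate-zero k))

  sumFin-+ : ∀ {k} (f g : Fin k → ℤ) →
    sumFin (λ i → f i + g i) ≡ sumFin f + sumFin g
  sumFin-+ f g = begin
    sumFin (λ i → f i + g i) ≡⟨ sumFin≡sum (λ i → f i + g i) ⟩
    sum (λ i → f i + g i)    ≡⟨ ∑-distrib-+ f g ⟩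
    sum f + sum g            ≡⟨ cong₂ _+_ (sumFin≡sum f) (sumFin≡sum g) ⟨
    sumFin f + sumFin g      ∎

  sumFin-*ˡ : ∀ {k} (a : ℤ) (f : Fin k → ℤ) → a · sumFin f ≡ sumFin (λ i → a · f i)
  sumFin-*ˡ a f = begin
    a · sumFin f             ≡⟨ cong (a ·_) (sumFin≡sum f) ⟩
    a · sum f                ≡⟨ *-distribˡ-sum a f ⟩
    sum (λ i → a · f i)      ≡⟨ sumFin≡sum (λ i → a · f i) ⟨
    sumFin (λ i → a · f i)   ∎

  sumFin-neg : ∀ {k} (f : Fin k → ℤ) → sumFin (λ i → - f i) ≡ - sumFin f
  sumFin-neg f = begin
    sumFin (λ i → - f i)     ≡⟨ sumFin-cong (λ i → -1*i≡-i (f i)) ⟨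
    sumFin (λ i → -1ℤ · f i) ≡⟨ sumFin-*ˡ -1ℤ f ⟨
    -1ℤ · sumFin f           ≡⟨ -1*i≡-i (sumFin f) ⟩
    - sumFin f               ∎

  sumFin-comm : ∀ {k l} (H : Fin k → Fin l → ℤ) →
    sumFin (λ x → sumFin (H x)) ≡ sumFin (λ y → sumFin (λ x → H x y))
  sumFin-comm H = begin
    sumFin (λ x → sumFin (H x))             ≡⟨ sumFin₂≡sum₂ H ⟩
    sum (λ x → sum (H x))                   ≡⟨ ∑-comm H ⟩
    sum (λ y → sum (λ x → H x y))           ≡⟨ sumFin₂≡sum₂ (λ y x → H x y) ⟨
    sumFin (λ y → sumFin (λ x → H x y))     ∎

  sumFin-remove : ∀ {k} (i : Fin (suc k)) (f : Fin (suc k) → ℤ) →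
    sumFin f ≡ f i + sumFin (f ∘ punchIn i)
  sumFin-remove i f = begin
    sumFin f                     ≡⟨ sumFin≡sum f ⟩
    sum f                        ≡⟨ sum-remove f ⟩
    f i + sum (f ∘ punchIn i)    ≡⟨ cong (λ s → f i + s) (sumFin≡sum (f ∘ punchIn i)) ⟨
    f i + sumFin (f ∘ punchIn i) ∎

module Determinants where
  open import Data.Fin using (toℕ; fromℕ; punchOut)
  open import Data.Fin.Properties
    using (toℕ-fromℕ; _≟_; punchInᵢ≢i; punchOut-cong; punchOut-punchIn; punchIn-punchOut)
  open import Data.Integer using (-[1+_]; _+_; _-_)
  open import Data.Integer.Properties
    using (+-identityˡ; +-identityʳ; *-identityˡ; *-zeroˡ; *-zeroʳ; *-comm; neg-distribˡ-*; i≡j⇒i-j≡0; -1*i≡-i)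
  open import Data.Integer.Tactic.RingSolver using (solve-∀)
  open import Data.Empty using (⊥-elim)
  open import Relation.Nullary using (Dec; yes; no)
  open FiniteSums
  open ≡-Reasoning

  withTopRow : ∀ {m} → (Fin (suc m) → ℤ) → Matrix (suc m) → Matrix (suc m)
  withTopRow u A zero    = u
  withTopRow u A (suc r) = A (suc r)

  det-cong : ∀ {m} {A B : Matrix m} → (∀ r c → A r c ≡ B r c) → det A ≡ det B
  det-cong {zero}  A≗B = refl
  det-cong {suc m} A≗B = sumFin-cong λ j →
    cong₂ (λ a d → sgn (toℕ j) · (a · d)) (A≗B zero j) (det-cong (λ r c → A≗B (suc r) (punchIn j c)))

  term-zeroˡ : ∀ s {a} d → a ≡ + 0 → s · (a · d) ≡ + 0
  term-zeroˡ s d refl = trans (cong (s ·_) (*-zeroˡ d)) (*-zeroʳ s)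

  term-zeroʳ : ∀ s a {d} → d ≡ + 0 → s · (a · d) ≡ + 0
  term-zeroʳ s a refl = trans (cong (s ·_) (*-zeroʳ a)) (*-zeroʳ s)

  scale-one : ∀ a d → a ≡ + 1 → a · d ≡ d
  scale-one a d refl = *-identityˡ d

  cofactorTerm : ∀ {m} → Matrix (suc m) → Fin (suc m) → ℤ
  cofactorTerm A j = sgn (toℕ j) · (A zero j · det (minor A j))

  det-topRow-+ : ∀ {m} (u v : Fin (suc m) → ℤ) (A : Matrix (suc m)) →
    det (withTopRow (λ c → u c + v c) A) ≡ det (withTopRow u A) + det (withTopRow v A)
  det-topRow-+ u v A =
    trans (sumFin-cong (λ j → distrib (sgn (toℕ j)) (u j) (v j) (det (minor A j))))
          (sumFin-+ (cofactorTerm (withTopRow u A)) (cofactorTerm (withTopRow v A)))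
    where
    distrib : ∀ s a b d → s · ((a + b) · d) ≡ s · (a · d) + s · (b · d)
    distrib = solve-∀

  -- Deleting columns x and y of a matrix, in either order, leaves the same columns:
  -- the composite embeddings Fin n → Fin (2+n) agree.
  punchIn-pair-comm : ∀ {n} {x y : Fin (suc (suc n))} (x≢y : x ≢ y) (y≢x : y ≢ x) (z : Fin n) →
    punchIn x (punchIn (punchOut x≢y) z) ≡ punchIn y (punchIn (punchOut y≢x) z)
  punchIn-pair-comm {x = zero}  {zero}  x≢y y≢x z = ⊥-elim (x≢y refl)
  punchIn-pair-comm {x = zero}  {suc y} x≢y y≢x z = refl
  punchIn-pair-comm {x = suc x} {zero}  x≢y y≢x z = refl
  punchIn-pair-comm {suc n} {suc x} {suc y} x≢y y≢x zero = refl
  punchIn-pair-comm {suc n} {suc x} {suc y} x≢y y≢x (suc z) =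
    cong suc (punchIn-pair-comm (x≢y ∘ cong suc) (y≢x ∘ cong suc) z)

  -- Sign bookkeeping of the double expansion: choosing columns x (row 0) and y (row 1)
  -- and choosing them the other way round contribute opposite signs.
  sgn-pair-antisym : ∀ {n} {x y : Fin (suc (suc n))} (x≢y : x ≢ y) (y≢x : y ≢ x) →
    sgn (toℕ x) · sgn (toℕ (punchOut x≢y)) ≡ - (sgn (toℕ y) · sgn (toℕ (punchOut y≢x)))
  sgn-pair-antisym {x = zero}  {zero}  x≢y y≢x = ⊥-elim (x≢y refl)
  sgn-pair-antisym {x = zero}  {suc y} x≢y y≢x = flip (sgn (toℕ y))
    where
    flip : ∀ a → + 1 · a ≡ - (- a · + 1)
    flip = solve-∀
  sgn-pair-antisym {x = suc x} {zero}  x≢y y≢x = flip (sgn (toℕ x))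
    where
    flip : ∀ a → - a · + 1 ≡ - (+ 1 · a)
    flip = solve-∀
  sgn-pair-antisym {zero}  {suc zero} {suc zero} x≢y y≢x = ⊥-elim (x≢y refl)
  sgn-pair-antisym {suc n} {suc x} {suc y} x≢y y≢x = begin
    - sgn (toℕ x) · - sgn (toℕ x′)   ≡⟨ negate² (sgn (toℕ x)) (sgn (toℕ x′)) ⟩
    sgn (toℕ x) · sgn (toℕ x′)       ≡⟨ sgn-pair-antisym (x≢y ∘ cong suc) (y≢x ∘ cong suc) ⟩
    - (sgn (toℕ y) · sgn (toℕ y′))   ≡⟨ cong -_ (negate² (sgn (toℕ y)) (sgn (toℕ y′))) ⟨
    - (- sgn (toℕ y) · - sgn (toℕ y′)) ∎
    where
    x′ = punchOut (x≢y ∘ cong suc)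
    y′ = punchOut (y≢x ∘ cong suc)
    negate² : ∀ a b → - a · - b ≡ a · b
    negate² = solve-∀

  self-negative : ∀ {a : ℤ} → a ≡ - a → a ≡ + 0
  self-negative {+ zero}  _ = refl
  self-negative {+ suc n} ()
  self-negative { -[1+ n ]} ()

  -- A matrix whose two top rows coincide has determinant 0.  Expanding along row 0 and
  -- then row 1 writes det A as a sum over ordered pairs x ≠ y of columns; the terms for
  -- (x,y) and (y,x) cancel, so the sum equals its own negative.
  module EqualTopRows {n : ℕ} (A : Matrix (suc (suc n))) where

    expansionTerm : Fin (suc (suc n)) → Fin (suc n) → ℤ
    expansionTerm x c = sgn (toℕ x) · (A zero x · cofactorTerm (minor A x) c)

    det-doubleExpansion : det A ≡ sumFin (λ x → sumFin (expansionTerm x))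
    det-doubleExpansion = sumFin-cong λ x →
      trans (cong (sgn (toℕ x) ·_) (sumFin-*ˡ (A zero x) (cofactorTerm (minor A x))))
            (sumFin-*ˡ (sgn (toℕ x)) (λ c → A zero x · cofactorTerm (minor A x) c))

    pairTerm : (x y : Fin (suc (suc n))) → Dec (x ≡ y) → ℤ
    pairTerm x y (yes _)  = + 0
    pairTerm x y (no x≢y) = expansionTerm x (punchOut x≢y)

    columnPairTerm : Fin (suc (suc n)) → Fin (suc (suc n)) → ℤ
    columnPairTerm x y = pairTerm x y (x ≟ y)

    columnPairTerm-diag : ∀ x → columnPairTerm x x ≡ + 0
    columnPairTerm-diag x with x ≟ x
    ... | yes _   = refl
    ... | no x≢x = ⊥-elim (x≢x refl)

    columnPairTerm-punchIn : ∀ x c → columnPairTerm x (punchIn x c) ≡ expansionTerm x c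
    columnPairTerm-punchIn x c with x ≟ punchIn x c
    ... | yes x≡ = ⊥-elim (punchInᵢ≢i x c (sym x≡))
    ... | no x≢  = cong (expansionTerm x) (trans (punchOut-cong x refl) (punchOut-punchIn x))

    rowSum : ∀ x → sumFin (columnPairTerm x) ≡ sumFin (expansionTerm x)
    rowSum x = begin
      sumFin (columnPairTerm x)
        ≡⟨ sumFin-remove x (columnPairTerm x) ⟩
      columnPairTerm x x + sumFin (columnPairTerm x ∘ punchIn x)
        ≡⟨ cong₂ _+_ (columnPairTerm-diag x) (sumFin-cong (columnPairTerm-punchIn x)) ⟩
      + 0 + sumFin (expansionTerm x)
        ≡⟨ +-identityˡ _ ⟩
      sumFin (expansionTerm x) ∎

    pairTerm-normal : ∀ {x y} (x≢y : x ≢ y) →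
      expansionTerm x (punchOut x≢y) ≡
        (sgn (toℕ x) · sgn (toℕ (punchOut x≢y))) ·
        ((A zero x · A (suc zero) y) · det (minor (minor A x) (punchOut x≢y)))
    pairTerm-normal {x} {y} x≢y = begin
      expansionTerm x (punchOut x≢y)
        ≡⟨ cong (λ z → sgn (toℕ x) · (A zero x · (s · (A (suc zero) z · D)))) (punchIn-punchOut x≢y) ⟩
      sgn (toℕ x) · (A zero x · (s · (A (suc zero) y · D)))
        ≡⟨ regroup (sgn (toℕ x)) (A zero x) s (A (suc zero) y) D ⟩
      (sgn (toℕ x) · s) · ((A zero x · A (suc zero) y) · D) ∎
      where
      s = sgn (toℕ (punchOut x≢y))
      D = det (minor (minor A x) (punchOut x≢y))
      regroup : ∀ t a s b d → t · (a · (s · (b · d))) ≡ (t · s) · ((a · b) · d)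
      regroup = solve-∀

    module _ (rows≡ : ∀ c → A zero c ≡ A (suc zero) c) where

      columnPairTerm-antisym : ∀ x y → columnPairTerm x y ≡ - columnPairTerm y x
      columnPairTerm-antisym x y with x ≟ y | y ≟ x
      ... | yes _   | yes _   = refl
      ... | yes x≡y | no y≢x = ⊥-elim (y≢x (sym x≡y))
      ... | no x≢y | yes y≡x = ⊥-elim (x≢y (sym y≡x))
      ... | no x≢y | no y≢x  = begin
        expansionTerm x (punchOut x≢y)
          ≡⟨ pairTerm-normal x≢y ⟩
        (sgn (toℕ x) · sgn (toℕ (punchOut x≢y))) · ((A zero x · A (suc zero) y) · det (minor (minor A x) (punchOut x≢y)))
          ≡⟨ cong₂ _·_ (sgn-pair-antisym x≢y y≢x) (cong₂ _·_ entries minors) ⟩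
        (- s) · ((A zero y · A (suc zero) x) · det (minor (minor A y) (punchOut y≢x)))
          ≡⟨ neg-distribˡ-* s _ ⟨
        - (s · ((A zero y · A (suc zero) x) · det (minor (minor A y) (punchOut y≢x))))
          ≡⟨ cong -_ (pairTerm-normal y≢x) ⟨
        - expansionTerm y (punchOut y≢x) ∎
        where
        s = sgn (toℕ y) · sgn (toℕ (punchOut y≢x))
        entries : A zero x · A (suc zero) y ≡ A zero y · A (suc zero) x
        entries = trans (cong₂ _·_ (rows≡ x) (sym (rows≡ y))) (*-comm (A (suc zero) x) (A zero y))
        minors : det (minor (minor A x) (punchOut x≢y)) ≡ det (minor (minor A y) (punchOut y≢x))
        minors = det-cong (λ r z → cong (A (suc (suc r))) (punchIn-pair-comm x≢y y≢x z))

      det-equalTopRows : det A ≡ + 0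
      det-equalTopRows = trans det-doubleExpansion (self-negative (begin
        Σ (λ x → Σ (expansionTerm x))            ≡⟨ sumFin-cong rowSum ⟨
        Σ (λ x → Σ (columnPairTerm x))           ≡⟨ sumFin-comm columnPairTerm ⟩
        Σ (λ y → Σ (λ x → columnPairTerm x y))   ≡⟨ sumFin-cong (λ y → sumFin-cong (λ x → columnPairTerm-antisym x y)) ⟩
        Σ (λ y → Σ (λ x → - columnPairTerm y x)) ≡⟨ sumFin-cong (λ y → sumFin-neg (columnPairTerm y)) ⟩
        Σ (λ y → - Σ (columnPairTerm y))         ≡⟨ sumFin-neg (λ y → Σ (columnPairTerm y)) ⟩
        - Σ (λ y → Σ (columnPairTerm y))         ≡⟨ cong -_ (sumFin-cong rowSum) ⟩
        - Σ (λ x → Σ (expansionTerm x))          ∎))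
        where
        Σ : ∀ {k} → (Fin k → ℤ) → ℤ
        Σ = sumFin

  open EqualTopRows using (det-equalTopRows) public

  det-subtractRow : ∀ {n} (A : Matrix (suc (suc n))) →
    det (withTopRow (λ c → A zero c - A (suc zero) c) A) ≡ det A
  det-subtractRow A = sym (begin
    det A                                              ≡⟨ det-cong split ⟩
    det (withTopRow (λ c → difference c + row₁ c) A)   ≡⟨ det-topRow-+ difference row₁ A ⟩
    det (withTopRow difference A) + det (withTopRow row₁ A)
      ≡⟨ cong (λ t → det (withTopRow difference A) + t) (det-equalTopRows (withTopRow row₁ A) (λ c → refl)) ⟩
    det (withTopRow difference A) + + 0                ≡⟨ +-identityʳ _ ⟩
    det (withTopRow difference A)                      ∎)
    where
    row₁ = A (suc zero)
    difference = λ c → A zero c - row₁ c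
    split : ∀ r c → A r c ≡ withTopRow (λ c → difference c + row₁ c) A r c
    split zero    c = minus-plus (A zero c) (row₁ c)
      where
      minus-plus : ∀ a b → a ≡ (a - b) + b
      minus-plus = solve-∀
    split (suc r) c = refl

  det-singleEntryRow : ∀ {m} (A : Matrix (suc m)) (j : Fin (suc m)) →
    (∀ c → A zero (punchIn j c) ≡ + 0) → det A ≡ sgn (toℕ j) · (A zero j · det (minor A j))
  det-singleEntryRow A j off = begin
    det A                                                         ≡⟨ sumFin-remove j (cofactorTerm A) ⟩
    cofactorTerm A j + sumFin (cofactorTerm A ∘ punchIn j)         ≡⟨ cong (λ t → cofactorTerm A j + t) others ⟩
    cofactorTerm A j + + 0                                        ≡⟨ +-identityʳ _ ⟩
    cofactorTerm A j                                              ∎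
    where
    others : sumFin (cofactorTerm A ∘ punchIn j) ≡ + 0
    others = sumFin-zero (λ c → term-zeroˡ (sgn (toℕ (punchIn j c))) (det (minor A (punchIn j c))) (off c))

  -- A matrix whose first column vanishes has determinant 0: every minor of a nonzero
  -- entry of row 0 again has a vanishing first column.
  det-zeroFirstColumn : ∀ {m} (A : Matrix (suc m)) → (∀ r → A r zero ≡ + 0) → det A ≡ + 0
  det-zeroFirstColumn {m} A col₀ = sumFin-zero (vanishes m A col₀)
    where
    vanishes : ∀ m (A : Matrix (suc m)) → (∀ r → A r zero ≡ + 0) → ∀ j → cofactorTerm A j ≡ + 0
    vanishes m       A col₀ zero    = term-zeroˡ (+ 1) (det (minor A zero)) (col₀ zero)
    vanishes (suc m) A col₀ (suc j) =
      term-zeroʳ (sgn (toℕ (suc j))) (A zero (suc j)) (det-zeroFirstColumn (minor A (suc j)) (col₀ ∘ suc))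

  det-firstColumnTop : ∀ {m} (A : Matrix (suc (suc m))) → (∀ r → A (suc r) zero ≡ + 0) →
    det A ≡ A zero zero · det (minor A zero)
  det-firstColumnTop A col₀ = begin
    det A                                                  ≡⟨⟩
    cofactorTerm A zero + sumFin (cofactorTerm A ∘ suc)    ≡⟨ cong (λ t → cofactorTerm A zero + t) others ⟩
    cofactorTerm A zero + + 0                              ≡⟨ +-identityʳ _ ⟩
    + 1 · (A zero zero · det (minor A zero))               ≡⟨ *-identityˡ _ ⟩
    A zero zero · det (minor A zero)                       ∎
    where
    others : sumFin (cofactorTerm A ∘ suc) ≡ + 0
    others = sumFin-zero λ j →
      term-zeroʳ (sgn (toℕ (suc j))) (A zero (suc j)) (det-zeroFirstColumn (minor A (suc j)) col₀)

  -- Row reduction: if rows 0 and 1 differ only in column j, and by 1 there, then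
  -- subtracting row 1 from row 0 leaves the unit vector eⱼ, so
  -- det A = (-1)^j det (minor A j).
  det-unitDifference : ∀ {n} (A : Matrix (suc (suc n))) (j : Fin (suc (suc n))) →
    (∀ c → A zero (punchIn j c) ≡ A (suc zero) (punchIn j c)) →
    A zero j - A (suc zero) j ≡ + 1 →
    det A ≡ sgn (toℕ j) · det (minor A j)
  det-unitDifference A j agree pivot = begin
    det A                                          ≡⟨ det-subtractRow A ⟨
    det (withTopRow difference A)                  ≡⟨ det-singleEntryRow (withTopRow difference A) j vanish ⟩
    sgn (toℕ j) · (difference j · det (minor A j)) ≡⟨ cong (sgn (toℕ j) ·_) (scale-one (difference j) (det (minor A j)) pivot) ⟩
    sgn (toℕ j) · det (minor A j)                  ∎
    where
    difference = λ c → A zero c - A (suc zero) c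
    vanish : ∀ c → difference (punchIn j c) ≡ + 0
    vanish c = i≡j⇒i-j≡0 (agree c)

  det-lastColumnPivot : ∀ {n} (A : Matrix (suc (suc n))) (C : Matrix (suc n)) →
    (∀ c → A zero (punchIn (fromℕ (suc n)) c) ≡ A (suc zero) (punchIn (fromℕ (suc n)) c)) →
    A zero (fromℕ (suc n)) - A (suc zero) (fromℕ (suc n)) ≡ + 1 →
    (∀ r c → A (suc r) (punchIn (fromℕ (suc n)) c) ≡ C r c) →
    det A ≡ sgn (suc n) · det C
  det-lastColumnPivot {n} A C agree pivot minor≡C = begin
    det A                                                      ≡⟨ det-unitDifference A last agree pivot ⟩
    sgn (toℕ last) · det (minor A last)
      ≡⟨ cong₂ (λ k d → sgn k · d) (toℕ-fromℕ (suc n)) (det-cong {A = minor A last} minor≡C) ⟩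
    sgn (suc n) · det C                                        ∎
    where
    last = fromℕ (suc n)

  det-secondColumnPivot : ∀ {m} (A : Matrix (suc (suc (suc m)))) (C : Matrix (suc m)) →
    (∀ c → A zero (punchIn (suc zero) c) ≡ A (suc zero) (punchIn (suc zero) c)) →
    A zero (suc zero) - A (suc zero) (suc zero) ≡ + 1 →
    A (suc zero) zero ≡ + 1 →
    (∀ r → A (suc (suc r)) zero ≡ + 0) →
    (∀ r c → A (suc (suc r)) (suc (suc c)) ≡ C r c) →
    det A ≡ - det C
  det-secondColumnPivot {m} A C agree pivot corner column₀ minor≡C = begin
    det A                                        ≡⟨ det-unitDifference A col₁ agree pivot ⟩
    sgn (toℕ col₁) · det M                       ≡⟨ -1*i≡-i (det M) ⟩
    - det M                                      ≡⟨ cong -_ (det-firstColumnTop M column₀) ⟩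
    - (M zero zero · det (minor M zero))         ≡⟨ cong -_ (scale-one (M zero zero) (det (minor M zero)) corner) ⟩
    - det (minor M zero)                         ≡⟨ cong -_ (det-cong {A = minor M zero} minor≡C) ⟩
    - det C                                      ∎
    where
    col₁ : Fin (suc (suc (suc m)))
    col₁ = suc zero
    M = minor A col₁

open Determinants
open import Data.Nat using (_+_; _≡ᵇ_)
open import Data.Nat.Properties using (*-suc; *-distribˡ-+)
open import Data.Bool using (true; false)
open import Data.Fin using (toℕ; fromℕ)
open import Data.Fin.Properties using (toℕ-fromℕ)
open import Data.Integer using (_-_)
open import Data.Integer.Properties using (neg-involutive; neg-distribʳ-*)

-- Being pattern synonyms they expand to the
-- constructor form, so the sizes stay syntactically equal to those produced by the
-- determinant lemmas (Agda would otherwise compare determinants by unfolding them).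
pattern suc² k = suc (suc k)
pattern suc³ k = suc (suc² k)
pattern suc⁴ k = suc (suc³ k)
pattern suc⁵ k = suc (suc⁴ k)

≡ᵇ-refl : ∀ k → (k ≡ᵇ k) ≡ true
≡ᵇ-refl zero    = refl
≡ᵇ-refl (suc k) = ≡ᵇ-refl k

toℕ-≢ᵇ-bound : ∀ {n} (c : Fin n) → (toℕ c ≡ᵇ n) ≡ false
toℕ-≢ᵇ-bound zero    = refl
toℕ-≢ᵇ-bound (suc c) = toℕ-≢ᵇ-bound c

toℕ-punchIn-last : ∀ {n} (c : Fin n) → toℕ (punchIn (fromℕ n) c) ≡ toℕ c
toℕ-punchIn-last zero    = refl
toℕ-punchIn-last (suc c) = cong suc (toℕ-punchIn-last c)

sgn-2+ : ∀ k → sgn (suc² k) ≡ sgn k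
sgn-2+ k = neg-involutive (sgn k)

binEntry : ℕ → ℕ → ℕ → ℤ
binEntry m i j = parity (kurepaEntry (4 + m) i j)

binaryKurepa : (m : ℕ) → Matrix m
binaryKurepa m r c = binEntry m (suc (toℕ r)) (suc (toℕ c))

K′≡det : ∀ m → K′ (4 + m) ≡ det (binaryKurepa m)
K′≡det m = refl

tailMatrix : (s : ℕ) → Matrix s
tailMatrix s r c = binEntry (suc s) (2 + toℕ r) (1 + toℕ c)

row1-odd : ∀ m j → binEntry m 1 j ≡ + 1
row1-odd m j with j ≡ᵇ m
... | true  = refl
... | false = refl

-- Row 2 of M_N (m ≥ 3) is (3, 1, …, 1, 2): odd except in the last column.
row2-odd : ∀ k (c : Fin (2 + k)) → binEntry (3 + k) 2 (1 + toℕ c) ≡ + 1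
row2-odd k zero    = refl
row2-odd k (suc c) rewrite toℕ-≢ᵇ-bound c = refl

row2-last : ∀ k → binEntry (3 + k) 2 (3 + k) ≡ + 0
row2-last k rewrite ≡ᵇ-refl k = refl

-- Row 3 of M_N (m ≥ 4) is (1, 4, 1, …, 1, 2): odd from column 3 up to column m - 1.
row3-odd : ∀ s (c : Fin (1 + s)) → binEntry (4 + s) 3 (3 + toℕ c) ≡ + 1
row3-odd s c rewrite toℕ-≢ᵇ-bound c = refl

-- Column 1 of M_N is even from row 4 on: its entries there are 0, since the entry 1 of
-- the last row sits in column m - 1 ≥ 3.
column1-even : ∀ s (r : Fin (1 + s)) → binEntry (4 + s) (4 + toℕ r) 1 ≡ + 0
column1-even s r with toℕ r ≡ᵇ s
... | true  = refl
... | false = refl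

-- Below row 1 the pattern of M_N, read modulo 2, is invariant under shifting row, column
-- and size by 2: the entry a_{i,i-1} = i + 1 changes by 2, all others are unchanged.
binEntry-shift : ∀ m r j → binEntry (2 + m) (4 + r) (2 + j) ≡ binEntry m (2 + r) j
binEntry-shift m r j with 2 + r ≡ᵇ m | j ≡ᵇ m | suc j ≡ᵇ 2 + r
... | true  | _     | _     = refl
... | false | true  | _     = refl
... | false | false | true  = refl
... | false | false | false = refl

-- Rows 1 and 2 of B_m agree except in the last column, where they are 1 and 0; the
-- minor of that entry is the tail matrix.
det-binaryKurepa : ∀ k → det (binaryKurepa (suc³ k)) ≡ sgn (suc² k) · det (tailMatrix (suc² k))
det-binaryKurepa k =
  det-lastColumnPivot (binaryKurepa (suc³ k)) (tailMatrix (suc² k)) agree pivot minor≡tail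
  where
  last = fromℕ (suc² k)
  column : ∀ c → suc (toℕ (punchIn last c)) ≡ 1 + toℕ c
  column c = cong suc (toℕ-punchIn-last c)
  agree : ∀ c → binEntry (3 + k) 1 (suc (toℕ (punchIn last c)))
              ≡ binEntry (3 + k) 2 (suc (toℕ (punchIn last c)))
  agree c = trans (row1-odd (3 + k) (suc (toℕ (punchIn last c))))
                  (sym (trans (cong (binEntry (3 + k) 2) (column c)) (row2-odd k c)))
  pivot : binEntry (3 + k) 1 (suc (toℕ last)) - binEntry (3 + k) 2 (suc (toℕ last)) ≡ + 1
  pivot = cong₂ _-_ (row1-odd (3 + k) (suc (toℕ last)))
    (trans (cong (λ n → binEntry (3 + k) 2 (suc n)) (toℕ-fromℕ (2 + k))) (row2-last k))
  minor≡tail : ∀ r c → binEntry (3 + k) (2 + toℕ r) (suc (toℕ (punchIn last c)))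
                     ≡ tailMatrix (suc² k) r c
  minor≡tail r c = cong (binEntry (3 + k) (2 + toℕ r)) (column c)

-- Rows 1 and 2 of T_{s+4} are (1,1,1,…,1) and (1,0,1,…,1), its first column is
-- (1,1,0,…,0)ᵀ, and deleting its first two rows and columns gives T_{s+2}.
det-tail-step : ∀ s → det (tailMatrix (suc⁴ s)) ≡ - det (tailMatrix (suc² s))
det-tail-step s =
  det-secondColumnPivot (tailMatrix (suc⁴ s)) (tailMatrix (suc² s))
    agree refl refl (column1-even (1 + s)) (λ r c → binEntry-shift (3 + s) (toℕ r) (1 + toℕ c))
  where
  agree : ∀ c → tailMatrix (suc⁴ s) zero (punchIn (suc zero) c)
              ≡ tailMatrix (suc⁴ s) (suc zero) (punchIn (suc zero) c)
  agree zero    = refl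
  agree (suc c) = trans (row2-odd (2 + s) (suc² c)) (sym (row3-odd (1 + s) c))

K′-reduction : ∀ k → K′ (4 + suc³ k) ≡ sgn (suc² k) · det (tailMatrix (suc² k))
K′-reduction k = trans (K′≡det (suc³ k)) (det-binaryKurepa k)

-- K′_{N+2} = - K′_N for N ≥ 7.  The integer bookkeeping is a lemma with explicit
-- arguments, so that no determinant is unfolded while matching its statement.
K′-step : ∀ k → K′ (4 + suc⁵ k) ≡ - K′ (4 + suc³ k)
K′-step k =
  alternation (K′ (4 + suc⁵ k)) (K′ (4 + suc³ k))
              (sgn (suc⁴ k)) (sgn (suc² k))
              (det (tailMatrix (suc⁴ k))) (det (tailMatrix (suc² k)))
              (K′-reduction (suc² k)) (K′-reduction k) (sgn-2+ (suc² k)) (det-tail-step k)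
  where
  alternation : ∀ K₁ K₂ σ₁ σ₂ D₁ D₂ →
    K₁ ≡ σ₁ · D₁ → K₂ ≡ σ₂ · D₂ → σ₁ ≡ σ₂ → D₁ ≡ - D₂ → K₁ ≡ - K₂
  alternation K₁ K₂ σ₁ σ₂ D₁ D₂ refl refl refl refl = sym (neg-distribʳ-* σ₁ D₂)

K′-even : ∀ t → K′ (4 + suc⁴ (2 * t)) ≡ sgn t
K′-even zero    = refl
K′-even (suc t) =
  trans (cong (λ x → K′ (4 + suc⁴ x)) {x = 2 * suc t} {y = suc² (2 * t)} (*-suc 2 t))
        (trans (K′-step (suc (2 * t))) (cong -_ {x = K′ (4 + suc⁴ (2 * t))} (K′-even t)))

K′-odd : ∀ t → K′ (4 + suc³ (2 * t)) ≡ sgn t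
K′-odd zero    = refl
K′-odd (suc t) =
  trans (cong (λ x → K′ (4 + suc³ x)) {x = 2 * suc t} {y = suc² (2 * t)} (*-suc 2 t))
        (trans (K′-step (2 * t)) (cong -_ {x = K′ (4 + suc³ (2 * t))} (K′-odd t)))

proposition2 : (n : ℕ) → 4 ≤ n →
    (K′ (2 * n) ≡ sgn n) × (K′ (2 * n ∸ 1) ≡ sgn n)
proposition2 (suc⁴ t) (s≤s (s≤s (s≤s (s≤s z≤n)))) =
  trans (cong K′ {x = 2 * suc⁴ t} {y = 4 + suc⁴ (2 * t)} 2n≡2t+8)
        (trans (K′-even t) sgn-4+) ,
  trans (cong K′ {x = 2 * suc⁴ t ∸ 1} {y = 4 + suc³ (2 * t)} (cong (_∸ 1) 2n≡2t+8))
        (trans (K′-odd t) sgn-4+)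
  where
  2n≡2t+8 : 2 * suc⁴ t ≡ 8 + 2 * t
  2n≡2t+8 = *-distribˡ-+ 2 4 t
  sgn-4+ : sgn t ≡ sgn (suc⁴ t)
  sgn-4+ = sym (trans (sgn-2+ (suc² t)) (sgn-2+ t))
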